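{- The operators $\tilde T_n$ and the Hecke operators $T_n=\sum_{A\in S_n}A$ are related through $$T_n=\sum_{d^2\mid n}\begin{pmatrix}d&0\\0&d\end{pmatrix}\tilde T_{n/d^2}.$$ In particular they coincide if and only if $n$ is a product of distinct primes.
   Context: Let $S_n=\{\begin{pmatrix}a&b\\c&d\end{pmatrix}: a>c\ge0,\ d>b\ge0,\ ad-bc=n\}$ and let $T_n=\sum_{A\in S_n}A$ be M\"uhlenbruch's Hecke operator, an element of the free abelian group $\mathbb{Z}[\mathrm{Mat}_*(2,\mathbb{Z})]$, acting on period functions for $\mathrm{PSL}(2,\mathbb{Z})$ (solutions of $\phi(z)=\phi(z+1)+\lambda z^{ -2s}\phi(1+1/z)$, $\lambda=\pm1$) via the weight-$s$ slash action $(\phi\mid_s R)(z)=|\det R|^s(cz+d)^{ -2s}\phi\left(\frac{az+b}{cz+d}\right)$. The operator $\tilde T_n$ is the map $\phi\mapsto\sum_{i\in I_n}\phi\mid_s\psi_i$ obtained by summing the components of the special solution $(\phi\mid_s\psi_i)_{i\in I_n}$ of the Lewis equation for $\overline{\Gamma}_0(n)$ (where $I_n=\overline{\Gamma}_0(n)\backslash\mathrm{GL}(2,\mathbb{Z})$, $\overline{\Gamma}_0(n)=\{\begin{pmatrix}a&b\\c&d\end{pmatrix}\in\mathrm{GL}(2,\mathbb{Z}): c\equiv 0\bmod n\}$); equivalently $\tilde T_n=\sum_{A=\begin{pmatrix}a&b\\c&d\end{pmatrix}\in S_n,\ \gcd(a,b,c,d)=1}A$. The matrices $T_n$ and $\tilde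 T_{n/d^2}$ are identified with the operators they define via the slash action. -}

module Defs where

open import Data.Nat as ℕ using (ℕ; zero; suc; _≤_)
open import Data.Nat.Divisibility as ℕD using (_∣?_; quotient)
open import Data.Nat.GCD using (gcd)
open import Data.Nat.Primality using (Prime)
open import Data.Integer as ℤ using (ℤ; +_; ∣_∣; 0ℤ; 1ℤ)
open import Data.Integer.DivMod using (_/ℕ_)
import Data.Integer.Properties as ℤP
open import Data.List using (List; []; _∷_; foldr; upTo; map)
open import Data.Nat.ListAction using (product)
open import Data.List.Relation.Unary.All using (All)
open import Data.List.Relation.Unary.Unique.Propositional using (Unique)
open import Data.Product using (_×_; Σ)
open import Relation.Binary.PropositionalEquality using (_≡_)
open import Relation.Nullary using (Dec; yes; no)
open import Relation.Nullary.Decidable using (_×-dec_)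

record Mat : Set where
  constructor mat
  field
    a b c d : ℤ
open Mat public

det : Mat → ℤ
det M = a M ℤ.* d M ℤ.- b M ℤ.* c M

InS : ℕ → Mat → Set
InS n M = (c M ℤ.< a M) × (0ℤ ℤ.≤ c M) × (b M ℤ.< d M) × (0ℤ ℤ.≤ b M)
          × (det M ≡ + n)

InS? : ∀ n M → Dec (InS n M)
InS? n M = (c M ℤP.<? a M) ×-dec (0ℤ ℤP.≤? c M) ×-dec (b M ℤP.<? d M)
           ×-dec (0ℤ ℤP.≤? b M) ×-dec (det M ℤP.≟ + n)

Primitive : Mat → Set
Primitive M = gcd (gcd ∣ a M ∣ ∣ b M ∣) (gcd ∣ c M ∣ ∣ d M ∣) ≡ 1

Primitive? : ∀ M → Dec (Primitive M)
Primitive? M = gcd (gcd ∣ a M ∣ ∣ b M ∣) (gcd ∣ c M ∣ ∣ d M ∣) ℕ.≟ 1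

-- Elements of the free abelian group ℤ[Mat(2,ℤ)], represented by their
-- coefficient functions (equality = equality of all coefficients).
ZMat : Set
ZMat = Mat → ℤ

_≈_ : ZMat → ZMat → Set
X ≈ Y = ∀ M → X M ≡ Y M

_⊕_ : ZMat → ZMat → ZMat
(X ⊕ Y) M = X M ℤ.+ Y M

zeroZ : ZMat
zeroZ _ = 0ℤ

T : ℕ → ZMat
T n M with InS? n M
... | yes _ = 1ℤ
... | no  _ = 0ℤ

T̃ : ℕ → ZMat
T̃ n M with InS? n M ×-dec Primitive? M
... | yes _ = 1ℤ
... | no  _ = 0ℤ

-- Left multiplication by diag(δ,δ), δ = suc k ≥ 1, in ℤ[Mat]:
-- (diag(δ,δ)·X)(M) = X(M/δ) if δ divides every entry of M, else 0.
diagMul : ℕ → ZMat → ZMat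
diagMul k X M with (suc k ℕD.∣? ∣ a M ∣) ×-dec (suc k ℕD.∣? ∣ b M ∣)
                   ×-dec (suc k ℕD.∣? ∣ c M ∣) ×-dec (suc k ℕD.∣? ∣ d M ∣)
... | yes _ = X (mat (a M /ℕ suc k) (b M /ℕ suc k) (c M /ℕ suc k) (d M /ℕ suc k))
... | no  _ = 0ℤ

summand : ℕ → ℕ → ZMat
summand n k with (suc k ℕ.* suc k) ∣? n
... | yes p = diagMul k (T̃ (quotient p))
... | no  _ = zeroZ

-- Σ_{d² ∣ n} diag(d,d) T̃_{n/d²}  (d ranges over 1..n, which covers all d with d² ∣ n for n ≥ 1)
HeckeRHS : ℕ → ZMat
HeckeRHS n = foldr (λ k acc → summand n k ⊕ acc) zeroZ (upTo n)

-- n is a product of distinct primes (n = 1 is the empty product)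
ProductOfDistinctPrimes : ℕ → Set
ProductOfDistinctPrimes n =
  Σ (List ℕ) λ ps → All Prime ps × Unique ps × product ps ≡ n

-- Every A ∈ S_n factors uniquely as A = δ·A' with δ the gcd of its entries and A'
-- primitive; then det A' = n/δ² and A' inherits the inequalities defining S_{n/δ²}.
-- So the δ-th summand of the right-hand side is the indicator of "A ∈ S_n and gcd = δ",
-- and exactly one summand fires (δ² ∣ det A = n, so δ ≤ n). Hence every element of
-- S_n is primitive when n is squarefree, whereas diag(p, n/p) is a non-primitive
-- element of S_n when p² ∣ n.
module Submission where

open import Defs
open import Data.Nat as ℕ using (ℕ; zero; suc; _≤_; _<_; z≤n; s≤s; NonZero)
import Data.Nat.Properties as ℕP
open import Data.Nat.Divisibility as ℕD using (_∣_; divides; _∣?_; ∣-refl; ∣-trans)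
open import Data.Nat.GCD
  using (gcd; gcd[m,n]∣m; gcd[m,n]∣n; gcd-greatest; gcd[m,n]≡0⇒m≡0; c*gcd[m,n]≡gcd[cm,cn])
open import Data.Nat.Coprimality using (Coprime; coprime-divisor)
open import Data.Nat.Primality using (Prime; euclidsLemma; prime⇒irreducible; prime⇒nonZero; ¬prime[1])
open import Data.Nat.Primality.Factorisation
  using (factorise; factorisationHasAllPrimeFactors; PrimeFactorisation)
open import Data.Nat.ListAction using (product)
open import Data.Nat.ListAction.Properties using (∈⇒∣product)
import Data.Nat.Tactic.RingSolver as ℕSolver
open import Data.Integer as ℤ using (ℤ; +_; -[1+_]; ∣_∣; 0ℤ; 1ℤ)
import Data.Integer.Properties as ℤP
open import Data.Integer.DivMod using (_/ℕ_; _%ℕ_; a≡a%ℕn+[a/ℕn]*n)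
import Data.Integer.Divisibility.Signed as ℤD
open import Data.Integer.Tactic.RingSolver using (solve-∀)
open import Data.List using (List; []; _∷_; foldr; applyUpTo; upTo)
open import Data.List.Membership.Propositional using (_∈_)
open import Data.List.Relation.Unary.All as All using (All; []; _∷_)
open import Data.List.Relation.Unary.AllPairs using ([]; _∷_)
open import Data.List.Relation.Unary.Unique.Propositional using (Unique)
open import Data.Product using (_×_; _,_; proj₁; proj₂)
open import Data.Product.Function.NonDependent.Propositional using (_×-⇔_)
open import Data.Sum using (inj₁; inj₂; reduce)
open import Data.Empty using (⊥-elim)
open import Function using (_∘_)
open import Function.Bundles using (_⇔_; mk⇔; Equivalence)
open import Function.Construct.Composition using (_⇔-∘_)
open import Function.Construct.Symmetry using (⇔-sym)
open import Relation.Nullary using (Dec; yes; no; ¬_)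
open import Relation.Nullary.Decidable using (_×-dec_)
open import Relation.Binary.PropositionalEquality

open ≡-Reasoning

indicator : ∀ {P : Set} → Dec P → ℤ
indicator (yes _) = 1ℤ
indicator (no _)  = 0ℤ

indicator-yes : ∀ {P : Set} (P? : Dec P) → P → indicator P? ≡ 1ℤ
indicator-yes (yes _) _ = refl
indicator-yes (no ¬p) p = ⊥-elim (¬p p)

indicator-no : ∀ {P : Set} (P? : Dec P) → ¬ P → indicator P? ≡ 0ℤ
indicator-no (yes p) ¬p = ⊥-elim (¬p p)
indicator-no (no _)  _  = refl

indicator≡1⇒ : ∀ {P : Set} (P? : Dec P) → indicator P? ≡ 1ℤ → P
indicator≡1⇒ (yes p) _ = p

indicator-cong : ∀ {P Q : Set} (P? : Dec P) (Q? : Dec Q) → P ⇔ Q → indicator P? ≡ indicator Q?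
indicator-cong (yes _) (yes _) _   = refl
indicator-cong (yes p) (no ¬q) P⇔Q = ⊥-elim (¬q (Equivalence.to P⇔Q p))
indicator-cong (no ¬p) (yes q) P⇔Q = ⊥-elim (¬p (Equivalence.from P⇔Q q))
indicator-cong (no _)  (no _)  _   = refl

∑ : (ℕ → ℤ) → List ℕ → ℤ
∑ e = foldr (λ k acc → e k ℤ.+ acc) 0ℤ

foldr-⊕-apply : ∀ (F : ℕ → ZMat) l M → foldr (λ k acc → F k ⊕ acc) zeroZ l M ≡ ∑ (λ k → F k M) l
foldr-⊕-apply F []      M = refl
foldr-⊕-apply F (k ∷ l) M = cong (λ t → F k M ℤ.+ t) (foldr-⊕-apply F l M)

∑-applyUpTo-zero : ∀ {e f} m → (∀ i → i < m → e (f i) ≡ 0ℤ) → ∑ e (applyUpTo f m) ≡ 0ℤ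
∑-applyUpTo-zero             zero    _     = refl
∑-applyUpTo-zero {e} {f} (suc m) zeros = cong₂ ℤ._+_ (zeros 0 (s≤s z≤n))
  (∑-applyUpTo-zero {e} {f ∘ suc} m λ i i<m → zeros (suc i) (s≤s i<m))

∑-applyUpTo-single : ∀ {e f} m j → j < m → (∀ i → i < m → i ≢ j → e (f i) ≡ 0ℤ) →
                     ∑ e (applyUpTo f m) ≡ e (f j)
∑-applyUpTo-single {e} {f} (suc m) zero _ zeros = trans
  (cong (λ t → e (f 0) ℤ.+ t) (∑-applyUpTo-zero {e} {f ∘ suc} m λ i i<m → zeros (suc i) (s≤s i<m) λ ()))
  (ℤP.+-identityʳ _)
∑-applyUpTo-single {e} {f} (suc m) (suc j) (s≤s j<m) zeros = trans
  (cong₂ ℤ._+_ (zeros 0 (s≤s z≤n) λ ())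
    (∑-applyUpTo-single {e} {f ∘ suc} m j j<m λ i i<m i≢j →
      zeros (suc i) (s≤s i<m) (i≢j ∘ ℕP.suc-injective)))
  (ℤP.+-identityˡ _)

SquareFree : ℕ → Set
SquareFree n = ∀ {p} → Prime p → ¬ (p ℕ.* p ∣ n)

squareFree⇒m*m∣n⇒m≡1 : ∀ {n} → SquareFree n → ∀ m .{{_ : NonZero m}} → m ℕ.* m ∣ n → m ≡ 1
squareFree⇒m*m∣n⇒m≡1 squareFree m m²∣n with factorise m
... | record { factors = [] ; isFactorisation = m≡1 } = m≡1
... | record { factors = p ∷ ps ; isFactorisation = m≡p*P ; factorsPrime = p-prime ∷ _ } =
  ⊥-elim (squareFree p-prime (∣-trans (ℕD.*-pres-∣ p∣m p∣m) m²∣n))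
  where
  p∣m : p ∣ m
  p∣m = subst (p ∣_) (sym m≡p*P) (ℕD.m∣m*n (product ps))

prime∣prime⇒≡ : ∀ {p q} → Prime p → Prime q → p ∣ q → p ≡ q
prime∣prime⇒≡ p-prime q-prime p∣q with prime⇒irreducible q-prime p∣q
... | inj₁ refl = ⊥-elim (¬prime[1] p-prime)
... | inj₂ p≡q  = p≡q

coprime-prime² : ∀ {p q} → Prime p → Prime q → p ≢ q → Coprime (p ℕ.* p) q
coprime-prime² {p} p-prime q-prime p≢q (i∣p² , i∣q) with prime⇒irreducible q-prime i∣q
... | inj₁ i≡1 = i≡1
... | inj₂ refl =
  ⊥-elim (p≢q (sym (prime∣prime⇒≡ q-prime p-prime (reduce (euclidsLemma p p q-prime i∣p²)))))

distinctPrimes⇒squareFree : ∀ {ps} → All Prime ps → Unique ps → SquareFree (product ps)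
distinctPrimes⇒squareFree [] [] {p} p-prime p²∣1 =
  ¬prime[1] (subst Prime (ℕP.m*n≡1⇒n≡1 p p (ℕD.∣1⇒≡1 p²∣1)) p-prime)
distinctPrimes⇒squareFree {q ∷ qs} (q-prime ∷ qs-prime) (q∉qs ∷ qs-unique) {p} p-prime p²∣ with p ℕ.≟ q
... | yes refl = All.lookup q∉qs
      (factorisationHasAllPrimeFactors p-prime (ℕD.*-cancelˡ-∣ p {{prime⇒nonZero p-prime}} p²∣) qs-prime)
      refl
... | no p≢q = distinctPrimes⇒squareFree qs-prime qs-unique p-prime
      (coprime-divisor (coprime-prime² p-prime q-prime p≢q) p²∣)

squareFree⇒unique : ∀ {ps} → All Prime ps → SquareFree (product ps) → Unique ps
squareFree⇒unique [] _ = []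
squareFree⇒unique {q ∷ qs} (q-prime ∷ qs-prime) squareFree =
  All.tabulate (λ q′∈qs q≡q′ → squareFree q-prime
    (ℕD.*-monoʳ-∣ q (∈⇒∣product (subst (_∈ qs) (sym q≡q′) q′∈qs))))
  ∷ squareFree⇒unique qs-prime (λ p-prime p²∣ → squareFree p-prime (∣-trans p²∣ (ℕD.n∣m*n q)))

productOfDistinctPrimes⇔squareFree : ∀ {n} .{{_ : NonZero n}} → ProductOfDistinctPrimes n ⇔ SquareFree n
productOfDistinctPrimes⇔squareFree {n} = mk⇔ to from
  where
  to : ProductOfDistinctPrimes n → SquareFree n
  to (ps , ps-prime , ps-unique , product≡n) =
    subst SquareFree product≡n (distinctPrimes⇒squareFree ps-prime ps-unique)
  from : SquareFree n → ProductOfDistinctPrimes n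
  from squareFree = factors , factorsPrime ,
    squareFree⇒unique factorsPrime (subst SquareFree isFactorisation squareFree) ,
    sym isFactorisation
    where open PrimeFactorisation (factorise n)

content : Mat → ℕ
content M = gcd (gcd ∣ a M ∣ ∣ b M ∣) (gcd ∣ c M ∣ ∣ d M ∣)

infix 4 _∣ₘ_

_∣ₘ_ : ℕ → Mat → Set
k ∣ₘ M = (k ∣ ∣ a M ∣) × (k ∣ ∣ b M ∣) × (k ∣ ∣ c M ∣) × (k ∣ ∣ d M ∣)

content∣ₘ : ∀ M → content M ∣ₘ M
content∣ₘ M =
  ∣-trans left (gcd[m,n]∣m ∣ a M ∣ ∣ b M ∣) , ∣-trans left (gcd[m,n]∣n ∣ a M ∣ ∣ b M ∣) ,
  ∣-trans right (gcd[m,n]∣m ∣ c M ∣ ∣ d M ∣) , ∣-trans right (gcd[m,n]∣n ∣ c M ∣ ∣ d M ∣)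
  where
  left : content M ∣ gcd (∣ a M ∣) (∣ b M ∣)
  left  = gcd[m,n]∣m (gcd ∣ a M ∣ ∣ b M ∣) (gcd ∣ c M ∣ ∣ d M ∣)
  right : content M ∣ gcd (∣ c M ∣) (∣ d M ∣)
  right = gcd[m,n]∣n (gcd ∣ a M ∣ ∣ b M ∣) (gcd ∣ c M ∣ ∣ d M ∣)

∣ₘ⇒∣content : ∀ {k} M → k ∣ₘ M → k ∣ content M
∣ₘ⇒∣content M (k∣a , k∣b , k∣c , k∣d) = gcd-greatest (gcd-greatest k∣a k∣b) (gcd-greatest k∣c k∣d)

∣ₘ⇒k*k∣det : ∀ {k} M → k ∣ₘ M → k ℕ.* k ∣ ∣ det M ∣
∣ₘ⇒k*k∣det {k} M (k∣a , k∣b , k∣c , k∣d) =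
  subst (_∣ ∣ det M ∣) (ℤP.abs-* (+ k) (+ k))
    (ℤD.∣⇒∣ᵤ (ℤD.∣m∣n⇒∣m-n (k²∣product (a M) (d M) k∣a k∣d) (k²∣product (b M) (c M) k∣b k∣c)))
  where
  k²∣product : ∀ x y → k ∣ ∣ x ∣ → k ∣ ∣ y ∣ → (+ k ℤ.* + k) ℤD.∣ (x ℤ.* y)
  k²∣product x y k∣x k∣y =
    ℤD.∣-trans (ℤD.*-monoˡ-∣ (+ k) (ℤD.∣ᵤ⇒∣ {+ k} {x} k∣x)) (ℤD.*-monoʳ-∣ x (ℤD.∣ᵤ⇒∣ {+ k} {y} k∣y))

InS⇒content²∣n : ∀ {n M} → InS n M → content M ℕ.* content M ∣ n
InS⇒content²∣n {M = M} (_ , _ , _ , _ , det≡n) =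
  subst (λ z → content M ℕ.* content M ∣ ∣ z ∣) det≡n (∣ₘ⇒k*k∣det M (content∣ₘ M))

InS⇒content≢0 : ∀ {n M} → InS n M → content M ≢ 0
InS⇒content≢0 {M = M} (c<a , 0≤c , _) content≡0 = ℤP.<⇒≱ (subst (c M ℤ.<_) a≡0 c<a) 0≤c
  where
  a≡0 : a M ≡ 0ℤ
  a≡0 = ℤP.∣i∣≡0⇒i≡0 (gcd[m,n]≡0⇒m≡0 (gcd[m,n]≡0⇒m≡0 content≡0))

scale : ℤ → Mat → Mat
scale x M = mat (a M ℤ.* x) (b M ℤ.* x) (c M ℤ.* x) (d M ℤ.* x)

det-scale : ∀ x M → det (scale x M) ≡ det M ℤ.* (x ℤ.* x)
det-scale x M = identity (a M) (b M) (c M) (d M) x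
  where
  identity : ∀ a b c d x → (a ℤ.* x) ℤ.* (d ℤ.* x) ℤ.- (b ℤ.* x) ℤ.* (c ℤ.* x)
                         ≡ (a ℤ.* d ℤ.- b ℤ.* c) ℤ.* (x ℤ.* x)
  identity = solve-∀

content-scale : ∀ δ M → content (scale (+ δ) M) ≡ δ ℕ.* content M
content-scale δ M = begin
  gcd (gcd ∣ a M ℤ.* + δ ∣ ∣ b M ℤ.* + δ ∣) (gcd ∣ c M ℤ.* + δ ∣ ∣ d M ℤ.* + δ ∣)
    ≡⟨ cong₂ gcd (cong₂ gcd (∣x*δ∣ (a M)) (∣x*δ∣ (b M))) (cong₂ gcd (∣x*δ∣ (c M)) (∣x*δ∣ (d M))) ⟩
  gcd (gcd (δ ℕ.* ∣ a M ∣) (δ ℕ.* ∣ b M ∣)) (gcd (δ ℕ.* ∣ c M ∣) (δ ℕ.* ∣ d M ∣))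
    ≡⟨ sym (cong₂ gcd (c*gcd[m,n]≡gcd[cm,cn] δ _ _) (c*gcd[m,n]≡gcd[cm,cn] δ _ _)) ⟩
  gcd (δ ℕ.* gcd ∣ a M ∣ ∣ b M ∣) (δ ℕ.* gcd ∣ c M ∣ ∣ d M ∣)
    ≡⟨ sym (c*gcd[m,n]≡gcd[cm,cn] δ _ _) ⟩
  δ ℕ.* content M ∎
  where
  ∣x*δ∣ : ∀ x → ∣ x ℤ.* + δ ∣ ≡ δ ℕ.* ∣ x ∣
  ∣x*δ∣ x = trans (ℤP.abs-* x (+ δ)) (ℕP.*-comm ∣ x ∣ δ)

InS-scale : ∀ k q M → InS q M ⇔ InS (q ℕ.* (suc k ℕ.* suc k)) (scale (+ suc k) M)
InS-scale k q M = mk⇔ to from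
  where
  δ = + suc k
  to : InS q M → InS (q ℕ.* (suc k ℕ.* suc k)) (scale δ M)
  to (c<a , 0≤c , b<d , 0≤b , det≡q) =
    ℤP.*-monoʳ-<-pos δ c<a , ℤP.*-monoʳ-≤-nonNeg δ 0≤c ,
    ℤP.*-monoʳ-<-pos δ b<d , ℤP.*-monoʳ-≤-nonNeg δ 0≤b ,
    trans (det-scale δ M) (trans (cong (ℤ._* (δ ℤ.* δ)) det≡q) (sym (ℤP.pos-* q (suc k ℕ.* suc k))))
  from : InS (q ℕ.* (suc k ℕ.* suc k)) (scale δ M) → InS q M
  from (c<a , 0≤c , b<d , 0≤b , det≡n) =
    ℤP.*-cancelʳ-<-nonNeg δ c<a , ℤP.*-cancelʳ-≤-pos 0ℤ (c M) δ 0≤c ,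
    ℤP.*-cancelʳ-<-nonNeg δ b<d , ℤP.*-cancelʳ-≤-pos 0ℤ (b M) δ 0≤b ,
    ℤP.*-cancelʳ-≡ (det M) (+ q) (δ ℤ.* δ)
      (trans (sym (det-scale δ M)) (trans det≡n (ℤP.pos-* q (suc k ℕ.* suc k))))

primitive⇔content-scale : ∀ k M → Primitive M ⇔ content (scale (+ suc k) M) ≡ suc k
primitive⇔content-scale k M = mk⇔
  (λ content≡1 → trans (content-scale (suc k) M)
                   (trans (cong (suc k ℕ.*_) content≡1) (ℕP.*-identityʳ (suc k))))
  (λ content≡δ → ℕP.*-cancelˡ-≡ (content M) 1 (suc k)
                   (trans (sym (content-scale (suc k) M))
                     (trans content≡δ (sym (ℕP.*-identityʳ (suc k))))))

infixl 7 _/ₘ_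

_/ₘ_ : Mat → (δ : ℕ) → .{{NonZero δ}} → Mat
M /ₘ δ = mat (a M /ℕ δ) (b M /ℕ δ) (c M /ℕ δ) (d M /ℕ δ)

∣⇒%ℕ≡0 : ∀ x δ .{{_ : NonZero δ}} → δ ∣ ∣ x ∣ → x %ℕ δ ≡ 0
∣⇒%ℕ≡0 (+ n)    δ δ∣x = ℕD.n∣m⇒m%n≡0 n δ δ∣x
∣⇒%ℕ≡0 -[1+ n ] δ δ∣x with suc n ℕ.% δ | ℕD.n∣m⇒m%n≡0 (suc n) δ δ∣x
... | zero | _ = refl

∣⇒[x/ℕδ]*δ≡x : ∀ x δ .{{_ : NonZero δ}} → δ ∣ ∣ x ∣ → (x /ℕ δ) ℤ.* + δ ≡ x
∣⇒[x/ℕδ]*δ≡x x δ δ∣x = begin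
  (x /ℕ δ) ℤ.* + δ                  ≡⟨ ℤP.+-identityˡ _ ⟨
  + 0 ℤ.+ (x /ℕ δ) ℤ.* + δ          ≡⟨ cong (λ r → + r ℤ.+ (x /ℕ δ) ℤ.* + δ) (∣⇒%ℕ≡0 x δ δ∣x) ⟨
  + (x %ℕ δ) ℤ.+ (x /ℕ δ) ℤ.* + δ   ≡⟨ a≡a%ℕn+[a/ℕn]*n x δ ⟨
  x                                 ∎

scale-/ₘ : ∀ δ .{{_ : NonZero δ}} M → δ ∣ₘ M → scale (+ δ) (M /ₘ δ) ≡ M
scale-/ₘ δ M (δ∣a , δ∣b , δ∣c , δ∣d)
  rewrite ∣⇒[x/ℕδ]*δ≡x (a M) δ δ∣a | ∣⇒[x/ℕδ]*δ≡x (b M) δ δ∣b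
        | ∣⇒[x/ℕδ]*δ≡x (c M) δ δ∣c | ∣⇒[x/ℕδ]*δ≡x (d M) δ δ∣d = refl

T-indicator : ∀ n M → T n M ≡ indicator (InS? n M)
T-indicator n M with InS? n M
... | yes _ = refl
... | no _  = refl

T̃-indicator : ∀ n M → T̃ n M ≡ indicator (InS? n M ×-dec Primitive? M)
T̃-indicator n M with InS? n M ×-dec Primitive? M
... | yes _ = refl
... | no _  = refl

summand-indicator : ∀ n k M → summand n k M ≡ indicator (InS? n M ×-dec (content M ℕ.≟ suc k))
summand-indicator n k M with (suc k ℕ.* suc k) ∣? n
... | no δ²∤n = sym (indicator-no _ λ (M∈S , content≡δ) →
        δ²∤n (subst (λ g → g ℕ.* g ∣ n) content≡δ (InS⇒content²∣n M∈S)))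
... | yes (divides q n≡qδ²) with (suc k ∣? ∣ a M ∣) ×-dec (suc k ∣? ∣ b M ∣)
                                 ×-dec (suc k ∣? ∣ c M ∣) ×-dec (suc k ∣? ∣ d M ∣)
...   | no δ∤M = sym (indicator-no _ λ (_ , content≡δ) →
          δ∤M (subst (_∣ₘ M) content≡δ (content∣ₘ M)))
...   | yes δ∣M = trans (T̃-indicator q (M /ₘ suc k)) (indicator-cong _ _
          (subst₂ (λ m N → (InS q (M /ₘ suc k) × Primitive (M /ₘ suc k)) ⇔ (InS m N × content N ≡ suc k))
             (sym n≡qδ²) (scale-/ₘ (suc k) M δ∣M)
             (InS-scale k q (M /ₘ suc k) ×-⇔ primitive⇔content-scale k (M /ₘ suc k))))

T≈HeckeRHS : ∀ {n} → 1 ≤ n → T n ≈ HeckeRHS n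
T≈HeckeRHS {n} n≥1 M = begin
  T n M                              ≡⟨ T-indicator n M ⟩
  indicator (InS? n M)               ≡⟨ summands (InS? n M) ⟨
  ∑ (λ k → summand n k M) (upTo n)   ≡⟨ foldr-⊕-apply (summand n) (upTo n) M ⟨
  HeckeRHS n M                       ∎
  where
  summands : (M∈S? : Dec (InS n M)) → ∑ (λ k → summand n k M) (upTo n) ≡ indicator M∈S?
  summands (no M∉S) = ∑-applyUpTo-zero n λ k _ →
    trans (summand-indicator n k M) (indicator-no _ (M∉S ∘ proj₁))
  summands (yes M∈S) with content M in content≡
  ... | zero  = ⊥-elim (InS⇒content≢0 M∈S content≡)
  ... | suc g = begin
    ∑ (λ k → summand n k M) (upTo n)   ≡⟨ ∑-applyUpTo-single n g g<n others-vanish ⟩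
    summand n g M                      ≡⟨ summand-indicator n g M ⟩
    indicator (InS? n M ×-dec _)       ≡⟨ indicator-yes _ (M∈S , content≡) ⟩
    1ℤ                                 ∎
    where
    δ²∣n : suc g ℕ.* suc g ∣ n
    δ²∣n = subst (λ δ → δ ℕ.* δ ∣ n) content≡ (InS⇒content²∣n M∈S)
    g<n : g < n
    g<n = ℕP.≤-trans (ℕP.m≤m*n (suc g) (suc g)) (ℕD.∣⇒≤ {{ℕ.>-nonZero n≥1}} δ²∣n)
    others-vanish : ∀ k → k < n → k ≢ g → summand n k M ≡ 0ℤ
    others-vanish k _ k≢g = trans (summand-indicator n k M) (indicator-no _ λ (_ , content≡k) →
      k≢g (ℕP.suc-injective (trans (sym content≡k) content≡)))

T≈T̃⇔allPrimitive : ∀ n → (T n ≈ T̃ n) ⇔ (∀ M → InS n M → Primitive M)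
T≈T̃⇔allPrimitive n = mk⇔
  (λ T≈T̃ M M∈S → proj₂ (indicator≡1⇒ (InS? n M ×-dec Primitive? M)
    (trans (sym (T̃-indicator n M)) (trans (sym (T≈T̃ M))
      (trans (T-indicator n M) (indicator-yes (InS? n M) M∈S))))))
  (λ all-primitive M → trans (T-indicator n M) (trans
    (indicator-cong _ _ (mk⇔ (λ M∈S → M∈S , all-primitive M M∈S) proj₁))
    (sym (T̃-indicator n M))))

diag : ℕ → ℕ → Mat
diag x y = mat (+ x) 0ℤ 0ℤ (+ y)

diag∈S : ∀ x y .{{_ : NonZero x}} .{{_ : NonZero y}} → InS (x ℕ.* y) (diag x y)
diag∈S x y =
  ℤ.+<+ (ℕ.>-nonZero⁻¹ x) , ℤ.+≤+ z≤n , ℤ.+<+ (ℕ.>-nonZero⁻¹ y) , ℤ.+≤+ z≤n ,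
  trans (ℤP.+-identityʳ _) (sym (ℤP.pos-* x y))

allPrimitive⇔squareFree : ∀ {n} .{{_ : NonZero n}} → (∀ M → InS n M → Primitive M) ⇔ SquareFree n
allPrimitive⇔squareFree {n} {{n≢0}} = mk⇔ to from
  where
  to : (∀ M → InS n M → Primitive M) → SquareFree n
  to all-primitive {p} p-prime (divides s n≡s*p²) =
    ¬prime[1] (subst Prime (ℕD.∣1⇒≡1 (subst (p ∣_) (all-primitive _ diag∈Sₙ) p∣content)) p-prime)
    where
    n≡p*sp : n ≡ p ℕ.* (s ℕ.* p)
    n≡p*sp = trans n≡s*p² (rearrange s p)
      where
      rearrange : ∀ s p → s ℕ.* (p ℕ.* p) ≡ p ℕ.* (s ℕ.* p)
      rearrange = ℕSolver.solve-∀
    instance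
      p≢0 : NonZero p
      p≢0 = prime⇒nonZero p-prime
      sp≢0 : NonZero (s ℕ.* p)
      sp≢0 = ℕP.m*n≢0⇒n≢0 p {{subst NonZero n≡p*sp n≢0}}
    diag∈Sₙ : InS n (diag p (s ℕ.* p))
    diag∈Sₙ = subst (λ m → InS m _) (sym n≡p*sp) (diag∈S p (s ℕ.* p))
    p∣content : p ∣ content (diag p (s ℕ.* p))
    p∣content = ∣ₘ⇒∣content (diag p (s ℕ.* p)) (∣-refl , p ℕD.∣0 , p ℕD.∣0 , ℕD.n∣m*n s)
  from : SquareFree n → ∀ M → InS n M → Primitive M
  from squareFree M M∈S = squareFree⇒m*m∣n⇒m≡1 squareFree (content M)
    {{ℕ.≢-nonZero (InS⇒content≢0 M∈S)}} (InS⇒content²∣n M∈S)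

proposition1p2 : (n : ℕ) → 1 ≤ n →
    (T n ≈ HeckeRHS n) × ((T n ≈ T̃ n) ⇔ ProductOfDistinctPrimes n)
proposition1p2 n n≥1 =
  T≈HeckeRHS n≥1 ,
  ⇔-sym productOfDistinctPrimes⇔squareFree ⇔-∘ (allPrimitive⇔squareFree ⇔-∘ T≈T̃⇔allPrimitive n)
  where
  instance
    n≢0 : NonZero n
    n≢0 = ℕ.>-nonZero n≥1
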